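{- Let $m,n\in\mathbb{N}_0$. Then \[ \int_{\mathbb{Z}_p}x_{(n)}x_{(m)}\,d\mu_{ -1}(x)=\sum_{k=0}^{m}(-1)^{m+n-k}\binom{m}{k}\binom{n}{k}\frac{k!\,(m+n-k)!}{2^{m+n-k}}. \]
   Context: $p$ is an odd prime. For a polynomial $f:\mathbb{Z}_p\to\mathbb{C}_p$ the fermionic $p$-adic integral is $\int_{\mathbb{Z}_p} f(x)\,d\mu_{ -1}(x)=\lim_{N\to\infty}\sum_{x=0}^{p^N-1}(-1)^xf(x)$. The falling factorial is $x_{(0)}=1$, $x_{(n)}=x(x-1)\cdots(x-n+1)$ for $n\in\mathbb{N}$; binomial coefficients $\binom{n}{k}$ vanish for $k>n$. -}

module Defs where

open import Data.Nat as ℕ using (ℕ; zero; suc; _∸_; _!; _≥_)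
open import Data.Nat.Combinatorics using (_C_)
open import Data.Integer as ℤ using (ℤ; +_)
open import Data.Rational using (ℚ; _+_; _*_; _-_; -_; _/_; 0ℚ; 1ℚ; ½)
open import Data.Nat.Divisibility using (_∣_)
open import Data.Product using (Σ; ∃; _×_)
open import Relation.Nullary using (¬_)
open import Relation.Binary.PropositionalEquality using (_≡_)

ℕ→ℚ : ℕ → ℚ
ℕ→ℚ n = + n / 1

ℤ→ℚ : ℤ → ℚ
ℤ→ℚ z = z / 1

pow : ℚ → ℕ → ℚ
pow q zero    = 1ℚ
pow q (suc n) = pow q n * q

sgn : ℕ → ℚ
sgn zero    = 1ℚ
sgn (suc x) = - sgn x

sumTo : ℕ → (ℕ → ℚ) → ℚ
sumTo zero    f = 0ℚ
sumTo (suc n) f = sumTo n f + f n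

falling : ℤ → ℕ → ℤ
falling x zero    = + 1
falling x (suc n) = falling x n ℤ.* (x ℤ.- + n)

-- p-adic smallness of a rational: v_p(q) ≥ M,
-- i.e. q = p^M * a / d with a ∈ ℤ, d ∈ ℕ, p ∤ d.
PAdicSmall : ℕ → ℕ → ℚ → Set
PAdicSmall p M q =
  Σ ℤ λ a → Σ ℕ λ d → (¬ (p ∣ d)) × (q * ℕ→ℚ d ≡ ℕ→ℚ (p ℕ.^ M) * ℤ→ℚ a)

fermionicSum : ℕ → (ℕ → ℚ) → ℕ → ℚ
fermionicSum p f N = sumTo (p ℕ.^ N) (λ x → sgn x * f x)

-- "∫_{Z_p} f dμ_{-1} = L": the sums converge p-adically to L
FermionicIntegralIs : ℕ → (ℕ → ℚ) → ℚ → Set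
FermionicIntegralIs p f L =
  ∀ M → ∃ λ N₀ → ∀ N → N ≥ N₀ → PAdicSmall p M (fermionicSum p f N - L)

rhs15 : ℕ → ℕ → ℚ
rhs15 m n = sumTo (suc m) λ k →
  sgn (m ℕ.+ n ∸ k) * ℕ→ℚ ((m C k) ℕ.* (n C k) ℕ.* (k !) ℕ.* ((m ℕ.+ n ∸ k) !))
    * pow ½ (m ℕ.+ n ∸ k)

{-# OPTIONS --safe #-}
module Submission where

-- In the falling-factorial basis, x_(n) x_(m) = Σ_k C(m,k) C(n,k) k! x_(m+n-k), so it suffices
-- to compare T(j) = Σ_{x<K} (-1)^x x_(j), for K = p^N, with E(j) = (-1)^j j! / 2^j.
-- For odd K, telescoping with Δ x_(j+1) = (j+1) x_(j) gives 2 T(j+1) + (j+1) T(j) = K_(j+1),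
-- and E satisfies the same recursion with right-hand side 0; both start at 1. As p is odd and
-- p^N divides K_(j+1), induction on j shows that p^N divides T(j) - E(j).

open import Defs
open import Data.Nat using (ℕ)
open import Data.Nat.Primality using (Prime)
open import Data.Nat.Divisibility using (_∣_)
open import Data.Integer using (+_)
open import Data.Rational using (_*_)
open import Relation.Nullary using (¬_)

open import Data.Nat as ℕ using (zero; suc; _∸_; _!; _≤_; _<_)
import Data.Nat.Properties as ℕP
import Data.Nat.Tactic.RingSolver as ℕ-Solver
open import Data.Nat.Combinatorics using (_C_; nCk+nC[k+1]≡[n+1]C[k+1])
open import Data.Nat.Combinatorics.Specification using (k>n⇒nCk≡0)
open import Data.Nat.Divisibility using (divides; ∣1⇒≡1; ∣-refl; _∣0)
open import Data.Nat.Primality using (prime[2]; prime⇒nonTrivial; euclidsLemma; irreducible[2])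
open import Data.Integer as ℤ using (ℤ)
import Data.Integer.Properties as ℤP
open import Data.Rational using (ℚ; _+_; -_; _-_; 0ℚ; 1ℚ; ½; toℚᵘ)
import Data.Rational.Properties as ℚP
import Data.Rational.Unnormalised as ℚᵘ
import Data.Rational.Unnormalised.Properties as ℚᵘP
open import Data.Empty using (⊥-elim)
open import Data.Product using (_,_)
open import Data.Sum using (inj₁; inj₂)
open import Function using (_∘_)
open import Level using (0ℓ)
open import Relation.Nullary.Decidable using (dec⇒maybe)
open import Relation.Binary.PropositionalEquality
open import Tactic.RingSolver using (solve-∀)
import Tactic.RingSolver.Core.AlmostCommutativeRing as ACR

ℚ-ring : ACR.AlmostCommutativeRing 0ℓ 0ℓ
ℚ-ring = ACR.fromCommutativeRing ℚP.+-*-commutativeRing (λ x → dec⇒maybe (0ℚ ℚP.≟ x))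

private
  ℤ→ℚ-toℚᵘ : ∀ z → toℚᵘ (ℤ→ℚ z) ℚᵘ.≃ ℚᵘ.mkℚᵘ z 0
  ℤ→ℚ-toℚᵘ z = ℚP.toℚᵘ-fromℚᵘ (ℚᵘ.mkℚᵘ z 0)

ℤ→ℚ-homo-* : ∀ a b → ℤ→ℚ (a ℤ.* b) ≡ ℤ→ℚ a * ℤ→ℚ b
ℤ→ℚ-homo-* a b = ℚP.toℚᵘ-injective (begin
  toℚᵘ (ℤ→ℚ (a ℤ.* b))              ≈⟨ ℤ→ℚ-toℚᵘ (a ℤ.* b) ⟩
  ℚᵘ.mkℚᵘ a 0 ℚᵘ.* ℚᵘ.mkℚᵘ b 0        ≈⟨ ℚᵘP.*-cong (ℤ→ℚ-toℚᵘ a) (ℤ→ℚ-toℚᵘ b) ⟨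
  toℚᵘ (ℤ→ℚ a) ℚᵘ.* toℚᵘ (ℤ→ℚ b)    ≈⟨ ℚP.toℚᵘ-homo-* (ℤ→ℚ a) (ℤ→ℚ b) ⟨
  toℚᵘ (ℤ→ℚ a * ℤ→ℚ b)              ∎)
  where open ℚᵘP.≃-Reasoning

ℤ→ℚ-homo-+ : ∀ a b → ℤ→ℚ (a ℤ.+ b) ≡ ℤ→ℚ a + ℤ→ℚ b
ℤ→ℚ-homo-+ a b = ℚP.toℚᵘ-injective (begin
  toℚᵘ (ℤ→ℚ (a ℤ.+ b))              ≈⟨ ℤ→ℚ-toℚᵘ (a ℤ.+ b) ⟩
  ℚᵘ.mkℚᵘ (a ℤ.+ b) 0                ≡⟨ cong₂ (λ u v → ℚᵘ.mkℚᵘ (u ℤ.+ v) 0) (ℤP.*-identityʳ a) (ℤP.*-identityʳ b) ⟨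
  ℚᵘ.mkℚᵘ a 0 ℚᵘ.+ ℚᵘ.mkℚᵘ b 0        ≈⟨ ℚᵘP.+-cong (ℤ→ℚ-toℚᵘ a) (ℤ→ℚ-toℚᵘ b) ⟨
  toℚᵘ (ℤ→ℚ a) ℚᵘ.+ toℚᵘ (ℤ→ℚ b)    ≈⟨ ℚP.toℚᵘ-homo-+ (ℤ→ℚ a) (ℤ→ℚ b) ⟨
  toℚᵘ (ℤ→ℚ a + ℤ→ℚ b)              ∎)
  where open ℚᵘP.≃-Reasoning

ℤ→ℚ-homo‿- : ∀ a → ℤ→ℚ (ℤ.- a) ≡ - ℤ→ℚ a
ℤ→ℚ-homo‿- a = ℚP.toℚᵘ-injective (begin
  toℚᵘ (ℤ→ℚ (ℤ.- a))    ≈⟨ ℤ→ℚ-toℚᵘ (ℤ.- a) ⟩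
  ℚᵘ.- ℚᵘ.mkℚᵘ a 0      ≈⟨ ℚᵘP.-‿cong (ℤ→ℚ-toℚᵘ a) ⟨
  ℚᵘ.- toℚᵘ (ℤ→ℚ a)     ≈⟨ ℚP.toℚᵘ-homo‿- (ℤ→ℚ a) ⟨
  toℚᵘ (- ℤ→ℚ a)        ∎)
  where open ℚᵘP.≃-Reasoning

ℕ→ℚ-homo-+ : ∀ a b → ℕ→ℚ (a ℕ.+ b) ≡ ℕ→ℚ a + ℕ→ℚ b
ℕ→ℚ-homo-+ a b = trans (cong ℤ→ℚ (ℤP.pos-+ a b)) (ℤ→ℚ-homo-+ (+ a) (+ b))

ℕ→ℚ-homo-* : ∀ a b → ℕ→ℚ (a ℕ.* b) ≡ ℕ→ℚ a * ℕ→ℚ b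
ℕ→ℚ-homo-* a b = trans (cong ℤ→ℚ (ℤP.pos-* a b)) (ℤ→ℚ-homo-* (+ a) (+ b))

ℕ→ℚ-suc : ∀ a → ℕ→ℚ (suc a) ≡ ℕ→ℚ a + 1ℚ
ℕ→ℚ-suc a = trans (cong ℕ→ℚ (ℕP.+-comm 1 a)) (ℕ→ℚ-homo-+ a 1)

ℕ→ℚ-∸ : ∀ {n k} → k ≤ n → ℕ→ℚ (n ∸ k) ≡ ℕ→ℚ n - ℕ→ℚ k
ℕ→ℚ-∸ {n} {k} k≤n = begin
  ℕ→ℚ (n ∸ k)                       ≡⟨ x≡x+y-y (ℕ→ℚ (n ∸ k)) (ℕ→ℚ k) ⟩
  ℕ→ℚ (n ∸ k) + ℕ→ℚ k - ℕ→ℚ k       ≡⟨ cong (_- ℕ→ℚ k) (ℕ→ℚ-homo-+ (n ∸ k) k) ⟨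
  ℕ→ℚ (n ∸ k ℕ.+ k) - ℕ→ℚ k         ≡⟨ cong (λ u → ℕ→ℚ u - ℕ→ℚ k) (ℕP.m∸n+n≡m k≤n) ⟩
  ℕ→ℚ n - ℕ→ℚ k                     ∎
  where
  open ≡-Reasoning
  x≡x+y-y : ∀ x y → x ≡ x + y - y
  x≡x+y-y = solve-∀ ℚ-ring

sumTo-cong : ∀ n {f g : ℕ → ℚ} → (∀ x → x < n → f x ≡ g x) → sumTo n f ≡ sumTo n g
sumTo-cong zero    f≗g = refl
sumTo-cong (suc n) f≗g =
  cong₂ _+_ (sumTo-cong n (λ x x<n → f≗g x (ℕP.m<n⇒m<1+n x<n))) (f≗g n ℕP.≤-refl)

sumTo-zero : ∀ n → sumTo n (λ _ → 0ℚ) ≡ 0ℚ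
sumTo-zero zero    = refl
sumTo-zero (suc n) = trans (ℚP.+-identityʳ _) (sumTo-zero n)

sumTo-distrib-+ : ∀ n (f g : ℕ → ℚ) → sumTo n (λ x → f x + g x) ≡ sumTo n f + sumTo n g
sumTo-distrib-+ zero    f g = refl
sumTo-distrib-+ (suc n) f g = begin
  sumTo n (λ x → f x + g x) + (f n + g n)     ≡⟨ cong (_+ (f n + g n)) (sumTo-distrib-+ n f g) ⟩
  sumTo n f + sumTo n g + (f n + g n)         ≡⟨ interchange (sumTo n f) (sumTo n g) (f n) (g n) ⟩
  sumTo n f + f n + (sumTo n g + g n)         ∎
  where
  open ≡-Reasoning
  interchange : ∀ a b c d → a + b + (c + d) ≡ a + c + (b + d)
  interchange = solve-∀ ℚ-ring

sumTo-distrib-sub : ∀ n (f g : ℕ → ℚ) → sumTo n (λ x → f x - g x) ≡ sumTo n f - sumTo n g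
sumTo-distrib-sub zero    f g = refl
sumTo-distrib-sub (suc n) f g = begin
  sumTo n (λ x → f x - g x) + (f n - g n)     ≡⟨ cong (_+ (f n - g n)) (sumTo-distrib-sub n f g) ⟩
  sumTo n f - sumTo n g + (f n - g n)         ≡⟨ interchange (sumTo n f) (sumTo n g) (f n) (g n) ⟩
  sumTo n f + f n - (sumTo n g + g n)         ∎
  where
  open ≡-Reasoning
  interchange : ∀ a b c d → a - b + (c - d) ≡ a + c - (b + d)
  interchange = solve-∀ ℚ-ring

*-distribˡ-sumTo : ∀ n c (f : ℕ → ℚ) → c * sumTo n f ≡ sumTo n (λ x → c * f x)
*-distribˡ-sumTo zero    c f = ℚP.*-zeroʳ c
*-distribˡ-sumTo (suc n) c f =
  trans (ℚP.*-distribˡ-+ c (sumTo n f) (f n)) (cong (_+ c * f n) (*-distribˡ-sumTo n c f))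

sumTo-sucˡ : ∀ n (f : ℕ → ℚ) → sumTo (suc n) f ≡ f 0 + sumTo n (λ x → f (suc x))
sumTo-sucˡ zero    f = trans (ℚP.+-identityˡ (f 0)) (sym (ℚP.+-identityʳ (f 0)))
sumTo-sucˡ (suc n) f = trans (cong (_+ f (suc n)) (sumTo-sucˡ n f)) (ℚP.+-assoc (f 0) _ _)

sumTo-comm : ∀ a b (g : ℕ → ℕ → ℚ) →
  sumTo a (λ x → sumTo b (g x)) ≡ sumTo b (λ k → sumTo a (λ x → g x k))
sumTo-comm zero    b g = sym (sumTo-zero b)
sumTo-comm (suc a) b g = trans (cong (_+ sumTo b (g a)) (sumTo-comm a b g))
  (sym (sumTo-distrib-+ b (λ k → sumTo a (λ x → g x k)) (g a)))

sumTo-pascal : ∀ m (U V W : ℕ → ℚ) → W 0 ≡ U 0 → (∀ k → W (suc k) ≡ V k + U (suc k)) →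
  U (suc m) ≡ 0ℚ → sumTo (suc (suc m)) W ≡ sumTo (suc m) U + sumTo (suc m) V
sumTo-pascal m U V W W₀ W-suc U-top = begin
  sumTo (suc (suc m)) W                                     ≡⟨ sumTo-sucˡ (suc m) W ⟩
  W 0 + sumTo (suc m) (λ k → W (suc k))                     ≡⟨ cong₂ _+_ W₀ (sumTo-cong (suc m) (λ k _ → W-suc k)) ⟩
  U 0 + sumTo (suc m) (λ k → V k + U (suc k))               ≡⟨ cong (λ u → U 0 + u) (sumTo-distrib-+ (suc m) V (λ k → U (suc k))) ⟩
  U 0 + (sumTo (suc m) V + (sumTo m (λ k → U (suc k)) + U (suc m)))
                                                            ≡⟨ cong (λ u → U 0 + (sumTo (suc m) V + (sumTo m (λ k → U (suc k)) + u))) U-top ⟩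
  U 0 + (sumTo (suc m) V + (sumTo m (λ k → U (suc k)) + 0ℚ)) ≡⟨ rearrange (U 0) (sumTo (suc m) V) (sumTo m (λ k → U (suc k))) ⟩
  (U 0 + sumTo m (λ k → U (suc k))) + sumTo (suc m) V       ≡⟨ cong (_+ sumTo (suc m) V) (sumTo-sucˡ m U) ⟨
  sumTo (suc m) U + sumTo (suc m) V                         ∎
  where
  open ≡-Reasoning
  rearrange : ∀ a b c → a + (b + (c + 0ℚ)) ≡ (a + c) + b
  rearrange = solve-∀ ℚ-ring

sgn-odd : ∀ n → ¬ (2 ∣ n) → sgn n ≡ - 1ℚ
sgn-odd zero          odd = ⊥-elim (odd (2 ∣0))
sgn-odd (suc zero)    odd = refl
sgn-odd (suc (suc n)) odd = trans (neg-involutive (sgn n)) (sgn-odd n (odd ∘ 2∣2+))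
  where
  neg-involutive : ∀ a → - - a ≡ a
  neg-involutive = solve-∀ ℚ-ring
  2∣2+ : 2 ∣ n → 2 ∣ suc (suc n)
  2∣2+ (divides q n≡q*2) = divides (suc q) (cong (suc ∘ suc) n≡q*2)

odd-^ : ∀ {p} → ¬ (2 ∣ p) → ∀ N → ¬ (2 ∣ p ℕ.^ N)
odd-^ odd zero    2∣1 with () ← ∣1⇒≡1 2∣1
odd-^ odd (suc N) 2∣p^[1+N] with euclidsLemma _ _ prime[2] 2∣p^[1+N]
... | inj₁ 2∣p   = odd 2∣p
... | inj₂ 2∣p^N = odd-^ odd N 2∣p^N

altSum : ℕ → (ℕ → ℚ) → ℚ
altSum K f = sumTo K (λ x → sgn x * f x)

altSum-telescope : ∀ K (g : ℕ → ℚ) → altSum K (λ x → g (suc x) + g x) ≡ g 0 - sgn K * g K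
altSum-telescope zero    g = base (g 0)
  where
  base : ∀ a → 0ℚ ≡ a - 1ℚ * a
  base = solve-∀ ℚ-ring
altSum-telescope (suc K) g = trans (cong (_+ sgn K * (g (suc K) + g K)) (altSum-telescope K g))
  (step (g 0) (sgn K) (g (suc K)) (g K))
  where
  step : ∀ a s b c → a - s * c + s * (b + c) ≡ a - (- s) * b
  step = solve-∀ ℚ-ring

altSum-distrib-+ : ∀ K (f g : ℕ → ℚ) → altSum K (λ x → f x + g x) ≡ altSum K f + altSum K g
altSum-distrib-+ K f g =
  trans (sumTo-cong K (λ x _ → ℚP.*-distribˡ-+ (sgn x) (f x) (g x))) (sumTo-distrib-+ K _ _)

*-distribˡ-altSum : ∀ K c (f : ℕ → ℚ) → c * altSum K f ≡ altSum K (λ x → c * f x)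
*-distribˡ-altSum K c f =
  trans (*-distribˡ-sumTo K c _) (sumTo-cong K (λ x _ → x∙yz≈y∙xz c (sgn x) (f x)))
  where
  x∙yz≈y∙xz : ∀ a b c → a * (b * c) ≡ b * (a * c)
  x∙yz≈y∙xz = solve-∀ ℚ-ring

altSum-sumTo : ∀ K r (c : ℕ → ℚ) (h : ℕ → ℕ → ℚ) →
  altSum K (λ x → sumTo r (λ k → c k * h k x)) ≡ sumTo r (λ k → c k * altSum K (h k))
altSum-sumTo K r c h = begin
  sumTo K (λ x → sgn x * sumTo r (λ k → c k * h k x))   ≡⟨ sumTo-cong K (λ x _ → *-distribˡ-sumTo r (sgn x) _) ⟩
  sumTo K (λ x → sumTo r (λ k → sgn x * (c k * h k x))) ≡⟨ sumTo-comm K r _ ⟩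
  sumTo r (λ k → altSum K (λ x → c k * h k x))          ≡⟨ sumTo-cong r (λ k _ → *-distribˡ-altSum K (c k) (h k)) ⟨
  sumTo r (λ k → c k * altSum K (h k))                  ∎
  where open ≡-Reasoning

fallingℚ : ℚ → ℕ → ℚ
fallingℚ y zero    = 1ℚ
fallingℚ y (suc j) = fallingℚ y j * (y - ℕ→ℚ j)

ℤ→ℚ-falling : ∀ z j → ℤ→ℚ (falling z j) ≡ fallingℚ (ℤ→ℚ z) j
ℤ→ℚ-falling z zero    = refl
ℤ→ℚ-falling z (suc j) = begin
  ℤ→ℚ (falling z j ℤ.* (z ℤ.- + j))           ≡⟨ ℤ→ℚ-homo-* (falling z j) (z ℤ.- + j) ⟩
  ℤ→ℚ (falling z j) * ℤ→ℚ (z ℤ.+ ℤ.- + j)     ≡⟨ cong₂ _*_ (ℤ→ℚ-falling z j) (ℤ→ℚ-homo-+ z (ℤ.- + j)) ⟩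
  fallingℚ (ℤ→ℚ z) j * (ℤ→ℚ z + ℤ→ℚ (ℤ.- + j)) ≡⟨ cong (λ u → fallingℚ (ℤ→ℚ z) j * (ℤ→ℚ z + u)) (ℤ→ℚ-homo‿- (+ j)) ⟩
  fallingℚ (ℤ→ℚ z) (suc j)                     ∎
  where open ≡-Reasoning

fallingℚ-zero : ∀ j → fallingℚ 0ℚ (suc j) ≡ 0ℚ
fallingℚ-zero zero    = refl
fallingℚ-zero (suc j) = trans (cong (_* (0ℚ - ℕ→ℚ (suc j))) (fallingℚ-zero j)) (ℚP.*-zeroˡ (0ℚ - ℕ→ℚ (suc j)))

fallingℚ-sucˡ : ∀ y j → fallingℚ y (suc j) ≡ y * fallingℚ (y - 1ℚ) j
fallingℚ-sucˡ y zero    = base y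
  where
  base : ∀ y → 1ℚ * (y - 0ℚ) ≡ y * 1ℚ
  base = solve-∀ ℚ-ring
fallingℚ-sucˡ y (suc j) = begin
  fallingℚ y (suc j) * (y - ℕ→ℚ (suc j))             ≡⟨ cong₂ (λ u v → u * (y - v)) (fallingℚ-sucˡ y j) (ℕ→ℚ-suc j) ⟩
  y * fallingℚ (y - 1ℚ) j * (y - (ℕ→ℚ j + 1ℚ))       ≡⟨ step y (fallingℚ (y - 1ℚ) j) (ℕ→ℚ j) ⟩
  y * (fallingℚ (y - 1ℚ) j * ((y - 1ℚ) - ℕ→ℚ j))     ∎
  where
  open ≡-Reasoning
  step : ∀ y f j → y * f * (y - (j + 1ℚ)) ≡ y * (f * ((y - 1ℚ) - j))
  step = solve-∀ ℚ-ring

fallingℚ-Δ : ∀ y j → fallingℚ (y + 1ℚ) (suc j) ≡ fallingℚ y (suc j) + ℕ→ℚ (suc j) * fallingℚ y j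
fallingℚ-Δ y zero    = step y
  where
  step : ∀ y → 1ℚ * ((y + 1ℚ) - 0ℚ) ≡ 1ℚ * (y - 0ℚ) + 1ℚ * 1ℚ
  step = solve-∀ ℚ-ring
fallingℚ-Δ y (suc j) = begin
  fallingℚ (y + 1ℚ) (suc j) * ((y + 1ℚ) - ℕ→ℚ (suc j))
    ≡⟨ cong (_* ((y + 1ℚ) - ℕ→ℚ (suc j))) (fallingℚ-Δ y j) ⟩
  (fallingℚ y (suc j) + ℕ→ℚ (suc j) * fallingℚ y j) * ((y + 1ℚ) - ℕ→ℚ (suc j))
    ≡⟨ cong (λ u → (fallingℚ y (suc j) + u * fallingℚ y j) * ((y + 1ℚ) - u)) (ℕ→ℚ-suc j) ⟩
  (fallingℚ y j * (y - ℕ→ℚ j) + (ℕ→ℚ j + 1ℚ) * fallingℚ y j) * ((y + 1ℚ) - (ℕ→ℚ j + 1ℚ))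
    ≡⟨ step (fallingℚ y j) y (ℕ→ℚ j) ⟩
  fallingℚ y (suc j) * (y - (ℕ→ℚ j + 1ℚ)) + ((ℕ→ℚ j + 1ℚ) + 1ℚ) * fallingℚ y (suc j)
    ≡⟨ cong₂ (λ u v → fallingℚ y (suc j) * (y - u) + v * fallingℚ y (suc j))
         (sym (ℕ→ℚ-suc j)) (trans (cong (_+ 1ℚ) (sym (ℕ→ℚ-suc j))) (sym (ℕ→ℚ-suc (suc j)))) ⟩
  fallingℚ y (suc (suc j)) + ℕ→ℚ (suc (suc j)) * fallingℚ y (suc j)
    ∎
  where
  open ≡-Reasoning
  step : ∀ f y j → (f * (y - j) + (j + 1ℚ) * f) * ((y + 1ℚ) - (j + 1ℚ))
                 ≡ f * (y - j) * (y - (j + 1ℚ)) + ((j + 1ℚ) + 1ℚ) * (f * (y - j))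
  step = solve-∀ ℚ-ring

ℕ→ℚ[nCk*k!]≡fallingℚ : ∀ n k → ℕ→ℚ ((n C k) ℕ.* k !) ≡ fallingℚ (ℕ→ℚ n) k
ℕ→ℚ[nCk*k!]≡fallingℚ n       zero    = refl
ℕ→ℚ[nCk*k!]≡fallingℚ zero    (suc k) = sym (fallingℚ-zero k)
ℕ→ℚ[nCk*k!]≡fallingℚ (suc n) (suc k) = begin
  ℕ→ℚ ((suc n C suc k) ℕ.* suc k !)
    ≡⟨ cong (λ c → ℕ→ℚ (c ℕ.* suc k !)) (nCk+nC[k+1]≡[n+1]C[k+1] n k) ⟨
  ℕ→ℚ (((n C k) ℕ.+ (n C suc k)) ℕ.* (suc k ℕ.* k !))
    ≡⟨ cong ℕ→ℚ (split (n C k) (n C suc k) (suc k) (k !)) ⟩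
  ℕ→ℚ (suc k ℕ.* ((n C k) ℕ.* k !) ℕ.+ (n C suc k) ℕ.* suc k !)
    ≡⟨ trans (ℕ→ℚ-homo-+ (suc k ℕ.* ((n C k) ℕ.* k !)) ((n C suc k) ℕ.* suc k !))
         (cong (_+ ℕ→ℚ ((n C suc k) ℕ.* suc k !)) (ℕ→ℚ-homo-* (suc k) ((n C k) ℕ.* k !))) ⟩
  ℕ→ℚ (suc k) * ℕ→ℚ ((n C k) ℕ.* k !) + ℕ→ℚ ((n C suc k) ℕ.* suc k !)
    ≡⟨ cong₂ (λ u v → ℕ→ℚ (suc k) * u + v) (ℕ→ℚ[nCk*k!]≡fallingℚ n k) (ℕ→ℚ[nCk*k!]≡fallingℚ n (suc k)) ⟩
  ℕ→ℚ (suc k) * fallingℚ (ℕ→ℚ n) k + fallingℚ (ℕ→ℚ n) (suc k)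
    ≡⟨ ℚP.+-comm (ℕ→ℚ (suc k) * fallingℚ (ℕ→ℚ n) k) (fallingℚ (ℕ→ℚ n) (suc k)) ⟩
  fallingℚ (ℕ→ℚ n) (suc k) + ℕ→ℚ (suc k) * fallingℚ (ℕ→ℚ n) k
    ≡⟨ fallingℚ-Δ (ℕ→ℚ n) k ⟨
  fallingℚ (ℕ→ℚ n + 1ℚ) (suc k)
    ≡⟨ cong (λ y → fallingℚ y (suc k)) (ℕ→ℚ-suc n) ⟨
  fallingℚ (ℕ→ℚ (suc n)) (suc k)
    ∎
  where
  open ≡-Reasoning
  split : ∀ a b s f → (a ℕ.+ b) ℕ.* (s ℕ.* f) ≡ s ℕ.* (a ℕ.* f) ℕ.+ b ℕ.* (s ℕ.* f)
  split = ℕ-Solver.solve-∀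

productCoeff : ℕ → ℕ → ℕ → ℚ
productCoeff n m k = ℕ→ℚ (m C k) * fallingℚ (ℕ→ℚ n) k

fallingℚ-product : ∀ n m y → fallingℚ y n * fallingℚ y m
  ≡ sumTo (suc m) (λ k → productCoeff n m k * fallingℚ y (m ℕ.+ n ∸ k))
fallingℚ-product n zero    y = base (fallingℚ y n)
  where
  base : ∀ a → a * 1ℚ ≡ 0ℚ + 1ℚ * 1ℚ * a
  base = solve-∀ ℚ-ring
fallingℚ-product n (suc m) y = begin
  fallingℚ y n * (fallingℚ y m * (y - ℕ→ℚ m))
    ≡⟨ x∙yz≈z∙xy (fallingℚ y n) (fallingℚ y m) (y - ℕ→ℚ m) ⟩
  (y - ℕ→ℚ m) * (fallingℚ y n * fallingℚ y m)
    ≡⟨ cong ((y - ℕ→ℚ m) *_) (fallingℚ-product n m y) ⟩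
  (y - ℕ→ℚ m) * sumTo (suc m) (λ k → productCoeff n m k * fallingℚ y (j k))
    ≡⟨ *-distribˡ-sumTo (suc m) (y - ℕ→ℚ m) _ ⟩
  sumTo (suc m) (λ k → (y - ℕ→ℚ m) * (productCoeff n m k * fallingℚ y (j k)))
    ≡⟨ sumTo-cong (suc m) (λ k k≤m → multiply k (ℕP.≤-trans (ℕP.<⇒≤pred k≤m) (ℕP.m≤m+n m n))) ⟩
  sumTo (suc m) (λ k → U k + V k)
    ≡⟨ sumTo-distrib-+ (suc m) U V ⟩
  sumTo (suc m) U + sumTo (suc m) V
    ≡⟨ sumTo-pascal m U V W refl W-suc U-top ⟨
  sumTo (suc (suc m)) W
    ∎
  where
  open ≡-Reasoning
  j : ℕ → ℕ
  j k = m ℕ.+ n ∸ k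
  U V W : ℕ → ℚ
  U k = productCoeff n m k * fallingℚ y (suc m ℕ.+ n ∸ k)
  V k = ℕ→ℚ (m C k) * fallingℚ (ℕ→ℚ n) (suc k) * fallingℚ y (j k)
  W k = productCoeff n (suc m) k * fallingℚ y (suc m ℕ.+ n ∸ k)

  x∙yz≈z∙xy : ∀ a b c → a * (b * c) ≡ c * (a * b)
  x∙yz≈z∙xy = solve-∀ ℚ-ring

  -- y - m = (y - j k) + (n - k): the first part raises the falling factorial, the second the coefficient.
  multiply : ∀ k → k ≤ m ℕ.+ n → (y - ℕ→ℚ m) * (productCoeff n m k * fallingℚ y (j k)) ≡ U k + V k
  multiply k k≤m+n = begin
    (y - ℕ→ℚ m) * (ℕ→ℚ (m C k) * fallingℚ (ℕ→ℚ n) k * fallingℚ y (j k))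
      ≡⟨ split (ℕ→ℚ (m C k)) (fallingℚ (ℕ→ℚ n) k) (fallingℚ y (j k)) y (ℕ→ℚ m) (ℕ→ℚ n) (ℕ→ℚ k) ⟩
    productCoeff n m k * (fallingℚ y (j k) * (y - ((ℕ→ℚ m + ℕ→ℚ n) - ℕ→ℚ k))) + V k
      ≡⟨ cong (λ u → productCoeff n m k * (fallingℚ y (j k) * (y - u)) + V k) j≡m+n-k ⟨
    productCoeff n m k * fallingℚ y (suc (j k)) + V k
      ≡⟨ cong (λ i → productCoeff n m k * fallingℚ y i + V k) (ℕP.+-∸-assoc 1 k≤m+n) ⟨
    U k + V k
      ∎
    where
    j≡m+n-k : ℕ→ℚ (j k) ≡ (ℕ→ℚ m + ℕ→ℚ n) - ℕ→ℚ k
    j≡m+n-k = trans (ℕ→ℚ-∸ k≤m+n) (cong (_- ℕ→ℚ k) (ℕ→ℚ-homo-+ m n))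
    split : ∀ a f g y m n k → (y - m) * (a * f * g) ≡ a * f * (g * (y - ((m + n) - k))) + a * (f * (n - k)) * g
    split = solve-∀ ℚ-ring

  W-suc : ∀ k → W (suc k) ≡ V k + U (suc k)
  W-suc k = begin
    ℕ→ℚ (suc m C suc k) * F * G                          ≡⟨ cong (λ c → ℕ→ℚ c * F * G) (nCk+nC[k+1]≡[n+1]C[k+1] m k) ⟨
    ℕ→ℚ ((m C k) ℕ.+ (m C suc k)) * F * G                ≡⟨ cong (λ c → c * F * G) (ℕ→ℚ-homo-+ (m C k) (m C suc k)) ⟩
    (ℕ→ℚ (m C k) + ℕ→ℚ (m C suc k)) * F * G              ≡⟨ distrib (ℕ→ℚ (m C k)) (ℕ→ℚ (m C suc k)) F G ⟩
    ℕ→ℚ (m C k) * F * G + ℕ→ℚ (m C suc k) * F * G        ∎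
    where
    F = fallingℚ (ℕ→ℚ n) (suc k)
    G = fallingℚ y (j k)
    distrib : ∀ a b f g → (a + b) * f * g ≡ a * f * g + b * f * g
    distrib = solve-∀ ℚ-ring

  U-top : U (suc m) ≡ 0ℚ
  U-top = begin
    ℕ→ℚ (m C suc m) * F * G   ≡⟨ cong (λ c → ℕ→ℚ c * F * G) (k>n⇒nCk≡0 (ℕP.n<1+n m)) ⟩
    0ℚ * F * G                ≡⟨ zero-* F G ⟩
    0ℚ                        ∎
    where
    F = fallingℚ (ℕ→ℚ n) (suc m)
    G = fallingℚ y (suc m ℕ.+ n ∸ suc m)
    zero-* : ∀ f g → 0ℚ * f * g ≡ 0ℚ
    zero-* = solve-∀ ℚ-ring

module PAdicSmallness {p : ℕ} (p-prime : Prime p) (M : ℕ) where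

  private
    Small : ℚ → Set
    Small = PAdicSmall p M

    pᴹ : ℚ
    pᴹ = ℕ→ℚ (p ℕ.^ M)

    p∤1 : ¬ (p ∣ 1)
    p∤1 p∣1 = ℕP.<⇒≢ (ℕ.nonTrivial⇒n>1 p {{prime⇒nonTrivial p-prime}}) (sym (∣1⇒≡1 p∣1))

    p∤* : ∀ {a b} → ¬ (p ∣ a) → ¬ (p ∣ b) → ¬ (p ∣ a ℕ.* b)
    p∤* p∤a p∤b p∣ab with euclidsLemma _ _ p-prime p∣ab
    ... | inj₁ p∣a = p∤a p∣a
    ... | inj₂ p∣b = p∤b p∣b

  small-0 : Small 0ℚ
  small-0 = + 0 , 1 , p∤1 , sym (ℚP.*-zeroʳ pᴹ)

  small-+ : ∀ {a b} → Small a → Small b → Small (a + b)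
  small-+ {a} {b} (u , d , p∤d , e) (v , d′ , p∤d′ , e′) =
    u ℤ.* + d′ ℤ.+ v ℤ.* + d , d ℕ.* d′ , p∤* p∤d p∤d′ , (begin
      (a + b) * ℕ→ℚ (d ℕ.* d′)                     ≡⟨ cong ((a + b) *_) (ℕ→ℚ-homo-* d d′) ⟩
      (a + b) * (ℕ→ℚ d * ℕ→ℚ d′)                   ≡⟨ cross a b (ℕ→ℚ d) (ℕ→ℚ d′) ⟩
      a * ℕ→ℚ d * ℕ→ℚ d′ + b * ℕ→ℚ d′ * ℕ→ℚ d      ≡⟨ cong₂ (λ x y → x * ℕ→ℚ d′ + y * ℕ→ℚ d) e e′ ⟩
      pᴹ * ℤ→ℚ u * ℕ→ℚ d′ + pᴹ * ℤ→ℚ v * ℕ→ℚ d     ≡⟨ factor pᴹ (ℤ→ℚ u) (ℤ→ℚ v) (ℕ→ℚ d) (ℕ→ℚ d′) ⟩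
      pᴹ * (ℤ→ℚ u * ℕ→ℚ d′ + ℤ→ℚ v * ℕ→ℚ d)       ≡⟨ cong (pᴹ *_) numerator ⟨
      pᴹ * ℤ→ℚ (u ℤ.* + d′ ℤ.+ v ℤ.* + d)          ∎)
    where
    open ≡-Reasoning
    cross : ∀ a b x y → (a + b) * (x * y) ≡ a * x * y + b * y * x
    cross = solve-∀ ℚ-ring
    factor : ∀ P u v x y → P * u * y + P * v * x ≡ P * (u * y + v * x)
    factor = solve-∀ ℚ-ring
    numerator : ℤ→ℚ (u ℤ.* + d′ ℤ.+ v ℤ.* + d) ≡ ℤ→ℚ u * ℕ→ℚ d′ + ℤ→ℚ v * ℕ→ℚ d
    numerator = trans (ℤ→ℚ-homo-+ (u ℤ.* + d′) (v ℤ.* + d))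
                      (cong₂ _+_ (ℤ→ℚ-homo-* u (+ d′)) (ℤ→ℚ-homo-* v (+ d)))

  small-ℤ* : ∀ z {q} → Small q → Small (ℤ→ℚ z * q)
  small-ℤ* z {q} (u , d , p∤d , e) = u ℤ.* z , d , p∤d , (begin
    ℤ→ℚ z * q * ℕ→ℚ d     ≡⟨ ℚP.*-assoc (ℤ→ℚ z) q (ℕ→ℚ d) ⟩
    ℤ→ℚ z * (q * ℕ→ℚ d)   ≡⟨ cong (ℤ→ℚ z *_) e ⟩
    ℤ→ℚ z * (pᴹ * ℤ→ℚ u)  ≡⟨ x∙yz≈y∙zx (ℤ→ℚ z) pᴹ (ℤ→ℚ u) ⟩
    pᴹ * (ℤ→ℚ u * ℤ→ℚ z)  ≡⟨ cong (pᴹ *_) (ℤ→ℚ-homo-* u z) ⟨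
    pᴹ * ℤ→ℚ (u ℤ.* z)    ∎)
    where
    open ≡-Reasoning
    x∙yz≈y∙zx : ∀ x y z → x * (y * z) ≡ y * (z * x)
    x∙yz≈y∙zx = solve-∀ ℚ-ring

  small-sub : ∀ {a b} → Small a → Small b → Small (a - b)
  small-sub {a} {b} small-a small-b = small-+ {a} { - b} small-a (subst Small (neg-one-* b) (small-ℤ* (ℤ.- + 1) {b} small-b))
    where
    neg-one-* : ∀ b → - 1ℚ * b ≡ - b
    neg-one-* = solve-∀ ℚ-ring

  small-sumTo : ∀ n {f : ℕ → ℚ} → (∀ k → Small (f k)) → Small (sumTo n f)
  small-sumTo zero    small-f = small-0
  small-sumTo (suc n) {f} small-f = small-+ {sumTo n f} {f n} (small-sumTo n small-f) (small-f n)

  small-halve : ¬ (2 ∣ p) → ∀ {q} → Small (q + q) → Small q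
  small-halve p-odd {q} (u , d , p∤d , e) = u , 2 ℕ.* d , p∤* p∤2 p∤d , (begin
    q * ℕ→ℚ (2 ℕ.* d)          ≡⟨ cong (q *_) (ℕ→ℚ-homo-* 2 d) ⟩
    q * ((1ℚ + 1ℚ) * ℕ→ℚ d)    ≡⟨ double q (ℕ→ℚ d) ⟩
    (q + q) * ℕ→ℚ d            ≡⟨ e ⟩
    pᴹ * ℤ→ℚ u                 ∎)
    where
    open ≡-Reasoning
    double : ∀ q d → q * ((1ℚ + 1ℚ) * d) ≡ (q + q) * d
    double = solve-∀ ℚ-ring
    p∤2 : ¬ (p ∣ 2)
    p∤2 p∣2 with irreducible[2] p∣2
    ... | inj₁ refl = p∤1 ∣-refl
    ... | inj₂ refl = p-odd p∣2

  small-p^N* : ∀ {N} → M ≤ N → ∀ z → Small (ℕ→ℚ (p ℕ.^ N) * ℤ→ℚ z)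
  small-p^N* {N} M≤N z = + (p ℕ.^ (N ∸ M)) ℤ.* z , 1 , p∤1 , (begin
    ℕ→ℚ (p ℕ.^ N) * ℤ→ℚ z * 1ℚ                      ≡⟨ ℚP.*-identityʳ _ ⟩
    ℕ→ℚ (p ℕ.^ N) * ℤ→ℚ z                           ≡⟨ cong (λ e → ℕ→ℚ (p ℕ.^ e) * ℤ→ℚ z) (ℕP.m+[n∸m]≡n M≤N) ⟨
    ℕ→ℚ (p ℕ.^ (M ℕ.+ (N ∸ M))) * ℤ→ℚ z             ≡⟨ cong (λ x → ℕ→ℚ x * ℤ→ℚ z) (ℕP.^-distribˡ-+-* p M (N ∸ M)) ⟩
    ℕ→ℚ (p ℕ.^ M ℕ.* p ℕ.^ (N ∸ M)) * ℤ→ℚ z         ≡⟨ cong (_* ℤ→ℚ z) (ℕ→ℚ-homo-* (p ℕ.^ M) (p ℕ.^ (N ∸ M))) ⟩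
    pᴹ * ℕ→ℚ (p ℕ.^ (N ∸ M)) * ℤ→ℚ z                ≡⟨ ℚP.*-assoc pᴹ _ _ ⟩
    pᴹ * (ℕ→ℚ (p ℕ.^ (N ∸ M)) * ℤ→ℚ z)              ≡⟨ cong (pᴹ *_) (ℤ→ℚ-homo-* (+ (p ℕ.^ (N ∸ M))) z) ⟨
    pᴹ * ℤ→ℚ (+ (p ℕ.^ (N ∸ M)) ℤ.* z)              ∎)
    where open ≡-Reasoning

  small-fallingℚ-p^N : ∀ {N} → M ≤ N → ∀ j → Small (fallingℚ (ℕ→ℚ (p ℕ.^ N)) (suc j))
  small-fallingℚ-p^N {N} M≤N j = subst Small (sym factor) (small-p^N* M≤N (falling (+ K ℤ.- + 1) j))
    where
    K = p ℕ.^ N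
    K-1 : ℤ→ℚ (+ K ℤ.- + 1) ≡ ℕ→ℚ K - 1ℚ
    K-1 = trans (ℤ→ℚ-homo-+ (+ K) (ℤ.- + 1)) (cong (λ u → ℕ→ℚ K + u) (ℤ→ℚ-homo‿- (+ 1)))
    factor : fallingℚ (ℕ→ℚ K) (suc j) ≡ ℕ→ℚ K * ℤ→ℚ (falling (+ K ℤ.- + 1) j)
    factor = trans (fallingℚ-sucˡ (ℕ→ℚ K) j)
      (cong (ℕ→ℚ K *_) (trans (cong (λ y → fallingℚ y j) (sym K-1)) (sym (ℤ→ℚ-falling (+ K ℤ.- + 1) j))))

altFallingSum : ℕ → ℕ → ℚ
altFallingSum K j = altSum K (λ x → fallingℚ (ℕ→ℚ x) j)

fallingIntegral : ℕ → ℚ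
fallingIntegral j = sgn j * ℕ→ℚ (j !) * pow ½ j

fallingIntegral-suc : ∀ j → fallingIntegral (suc j) + fallingIntegral (suc j) + ℕ→ℚ (suc j) * fallingIntegral j ≡ 0ℚ
fallingIntegral-suc j = begin
  (- s) * ℕ→ℚ (suc j ℕ.* j !) * (w * ½) + (- s) * ℕ→ℚ (suc j ℕ.* j !) * (w * ½) + c * (s * f * w)
    ≡⟨ cong (λ u → (- s) * u * (w * ½) + (- s) * u * (w * ½) + c * (s * f * w)) (ℕ→ℚ-homo-* (suc j) (j !)) ⟩
  (- s) * (c * f) * (w * ½) + (- s) * (c * f) * (w * ½) + c * (s * f * w)
    ≡⟨ cancel s c f w ⟩
  0ℚ
    ∎
  where
  open ≡-Reasoning
  s = sgn j
  c = ℕ→ℚ (suc j)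
  f = ℕ→ℚ (j !)
  w = pow ½ j
  cancel : ∀ s c f w → (- s) * (c * f) * (w * ½) + (- s) * (c * f) * (w * ½) + c * (s * f * w) ≡ 0ℚ
  cancel = solve-∀ ℚ-ring

module _ (K : ℕ) (K-odd : sgn K ≡ - 1ℚ) where

  altFallingSum-zero : altFallingSum K 0 + altFallingSum K 0 ≡ 1ℚ + 1ℚ
  altFallingSum-zero = begin
    altSum K (λ _ → 1ℚ) + altSum K (λ _ → 1ℚ)   ≡⟨ altSum-distrib-+ K (λ _ → 1ℚ) (λ _ → 1ℚ) ⟨
    altSum K (λ _ → 1ℚ + 1ℚ)                    ≡⟨ altSum-telescope K (λ _ → 1ℚ) ⟩
    1ℚ - sgn K * 1ℚ                             ≡⟨ cong (λ s → 1ℚ - s * 1ℚ) K-odd ⟩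
    1ℚ + 1ℚ                                     ∎
    where open ≡-Reasoning

  altFallingSum-suc : ∀ j → altFallingSum K (suc j) + altFallingSum K (suc j) + ℕ→ℚ (suc j) * altFallingSum K j
                            ≡ fallingℚ (ℕ→ℚ K) (suc j)
  altFallingSum-suc j = begin
    altSum K F + altSum K F + c * altSum K f        ≡⟨ cong (λ u → altSum K F + altSum K F + u) (*-distribˡ-altSum K c f) ⟩
    altSum K F + altSum K F + altSum K (λ x → c * f x)
                                                    ≡⟨ rearrange (altSum K F) (altSum K (λ x → c * f x)) ⟩
    (altSum K F + altSum K (λ x → c * f x)) + altSum K F
                                                    ≡⟨ cong (_+ altSum K F) (altSum-distrib-+ K F (λ x → c * f x)) ⟨
    altSum K (λ x → F x + c * f x) + altSum K F     ≡⟨ altSum-distrib-+ K (λ x → F x + c * f x) F ⟨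
    altSum K (λ x → (F x + c * f x) + F x)          ≡⟨ sumTo-cong K (λ x _ → cong (λ u → sgn x * (u + F x)) (Δ x)) ⟩
    altSum K (λ x → F (suc x) + F x)                ≡⟨ altSum-telescope K F ⟩
    F 0 - sgn K * F K                               ≡⟨ cong₂ (λ u s → u - s * F K) (fallingℚ-zero j) K-odd ⟩
    0ℚ - (- 1ℚ) * F K                               ≡⟨ neg-neg (F K) ⟩
    F K                                             ∎
    where
    open ≡-Reasoning
    F f : ℕ → ℚ
    F x = fallingℚ (ℕ→ℚ x) (suc j)
    f x = fallingℚ (ℕ→ℚ x) j
    c = ℕ→ℚ (suc j)
    Δ : ∀ x → F x + c * f x ≡ F (suc x)
    Δ x = trans (sym (fallingℚ-Δ (ℕ→ℚ x) j)) (cong (λ y → fallingℚ y (suc j)) (sym (ℕ→ℚ-suc x)))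
    rearrange : ∀ a b → a + a + b ≡ (a + b) + a
    rearrange = solve-∀ ℚ-ring
    neg-neg : ∀ a → 0ℚ - (- 1ℚ) * a ≡ a
    neg-neg = solve-∀ ℚ-ring

  altFallingSum-error-zero : (altFallingSum K 0 - fallingIntegral 0) + (altFallingSum K 0 - fallingIntegral 0) ≡ 0ℚ
  altFallingSum-error-zero = begin
    (T - 1ℚ) + (T - 1ℚ)     ≡⟨ regroup T ⟩
    (T + T) - (1ℚ + 1ℚ)     ≡⟨ cong (_- (1ℚ + 1ℚ)) altFallingSum-zero ⟩
    (1ℚ + 1ℚ) - (1ℚ + 1ℚ)   ≡⟨ ℚP.+-inverseʳ (1ℚ + 1ℚ) ⟩
    0ℚ                      ∎
    where
    open ≡-Reasoning
    T = altFallingSum K 0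
    regroup : ∀ t → (t - 1ℚ) + (t - 1ℚ) ≡ (t + t) - (1ℚ + 1ℚ)
    regroup = solve-∀ ℚ-ring

  altFallingSum-error-suc : ∀ j → let D = λ i → altFallingSum K i - fallingIntegral i in
    D (suc j) + D (suc j) ≡ fallingℚ (ℕ→ℚ K) (suc j) - ℕ→ℚ (suc j) * D j
  altFallingSum-error-suc j = begin
    (T′ - E′) + (T′ - E′)                                  ≡⟨ regroup T′ T E′ E c ⟩
    (T′ + T′ + c * T) - (E′ + E′ + c * E) - c * (T - E)    ≡⟨ cong₂ (λ u v → u - v - c * (T - E)) (altFallingSum-suc j) (fallingIntegral-suc j) ⟩
    fallingℚ (ℕ→ℚ K) (suc j) - 0ℚ - c * (T - E)           ≡⟨ minus-zero (fallingℚ (ℕ→ℚ K) (suc j)) (c * (T - E)) ⟩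
    fallingℚ (ℕ→ℚ K) (suc j) - c * (T - E)                 ∎
    where
    open ≡-Reasoning
    T′ = altFallingSum K (suc j)
    T  = altFallingSum K j
    E′ = fallingIntegral (suc j)
    E  = fallingIntegral j
    c  = ℕ→ℚ (suc j)
    regroup : ∀ T′ T E′ E c → (T′ - E′) + (T′ - E′) ≡ (T′ + T′ + c * T) - (E′ + E′ + c * E) - c * (T - E)
    regroup = solve-∀ ℚ-ring
    minus-zero : ∀ a b → a - 0ℚ - b ≡ a - b
    minus-zero = solve-∀ ℚ-ring

altFallingSum≈fallingIntegral : ∀ {p} → Prime p → ¬ (2 ∣ p) → ∀ {M N} → M ≤ N →
  ∀ j → PAdicSmall p M (altFallingSum (p ℕ.^ N) j - fallingIntegral j)
altFallingSum≈fallingIntegral {p} p-prime p-odd {M} {N} M≤N = small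
  where
  open PAdicSmallness p-prime M
  K-odd : sgn (p ℕ.^ N) ≡ - 1ℚ
  K-odd = sgn-odd (p ℕ.^ N) (odd-^ p-odd N)
  D : ℕ → ℚ
  D j = altFallingSum (p ℕ.^ N) j - fallingIntegral j
  small : ∀ j → PAdicSmall p M (D j)
  small zero    = small-halve p-odd {D 0}
    (subst (PAdicSmall p M) (sym (altFallingSum-error-zero (p ℕ.^ N) K-odd)) small-0)
  small (suc j) = small-halve p-odd {D (suc j)}
    (subst (PAdicSmall p M) (sym (altFallingSum-error-suc (p ℕ.^ N) K-odd j))
      (small-sub {fallingℚ (ℕ→ℚ (p ℕ.^ N)) (suc j)}
        (small-fallingℚ-p^N M≤N j) (small-ℤ* (+ suc j) {D j} (small j))))

productCoeff-ℤ : ∀ n m k → productCoeff n m k ≡ ℤ→ℚ (+ (m C k) ℤ.* falling (+ n) k)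
productCoeff-ℤ n m k =
  sym (trans (ℤ→ℚ-homo-* (+ (m C k)) (falling (+ n) k)) (cong (ℕ→ℚ (m C k) *_) (ℤ→ℚ-falling (+ n) k)))

altSum-falling-product : ∀ K m n →
  altSum K (λ x → ℤ→ℚ (falling (+ x) n) * ℤ→ℚ (falling (+ x) m))
    ≡ sumTo (suc m) (λ k → productCoeff n m k * altFallingSum K (m ℕ.+ n ∸ k))
altSum-falling-product K m n = trans
  (sumTo-cong K (λ x _ → cong (sgn x *_)
    (trans (cong₂ _*_ (ℤ→ℚ-falling (+ x) n) (ℤ→ℚ-falling (+ x) m)) (fallingℚ-product n m (ℕ→ℚ x)))))
  (altSum-sumTo K (suc m) (productCoeff n m) (λ k x → fallingℚ (ℕ→ℚ x) (m ℕ.+ n ∸ k)))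

rhs15-expansion : ∀ m n → rhs15 m n ≡ sumTo (suc m) (λ k → productCoeff n m k * fallingIntegral (m ℕ.+ n ∸ k))
rhs15-expansion m n = sumTo-cong (suc m) λ k _ → let j = m ℕ.+ n ∸ k in begin
  sgn j * ℕ→ℚ ((m C k) ℕ.* (n C k) ℕ.* k ! ℕ.* j !) * pow ½ j
    ≡⟨ cong (λ c → sgn j * c * pow ½ j) (coefficient k j) ⟩
  sgn j * (ℕ→ℚ (m C k) * fallingℚ (ℕ→ℚ n) k * ℕ→ℚ (j !)) * pow ½ j
    ≡⟨ regroup (sgn j) (productCoeff n m k) (ℕ→ℚ (j !)) (pow ½ j) ⟩
  productCoeff n m k * fallingIntegral j
    ∎
  where
  open ≡-Reasoning
  coefficient : ∀ k j → ℕ→ℚ ((m C k) ℕ.* (n C k) ℕ.* k ! ℕ.* j !) ≡ ℕ→ℚ (m C k) * fallingℚ (ℕ→ℚ n) k * ℕ→ℚ (j !)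
  coefficient k j = begin
    ℕ→ℚ ((m C k) ℕ.* (n C k) ℕ.* k ! ℕ.* j !)          ≡⟨ cong (λ c → ℕ→ℚ (c ℕ.* j !)) (ℕP.*-assoc (m C k) (n C k) (k !)) ⟩
    ℕ→ℚ ((m C k) ℕ.* ((n C k) ℕ.* k !) ℕ.* j !)        ≡⟨ ℕ→ℚ-homo-* ((m C k) ℕ.* ((n C k) ℕ.* k !)) (j !) ⟩
    ℕ→ℚ ((m C k) ℕ.* ((n C k) ℕ.* k !)) * ℕ→ℚ (j !)    ≡⟨ cong (_* ℕ→ℚ (j !)) (ℕ→ℚ-homo-* (m C k) ((n C k) ℕ.* k !)) ⟩
    ℕ→ℚ (m C k) * ℕ→ℚ ((n C k) ℕ.* k !) * ℕ→ℚ (j !)    ≡⟨ cong (λ f → ℕ→ℚ (m C k) * f * ℕ→ℚ (j !)) (ℕ→ℚ[nCk*k!]≡fallingℚ n k) ⟩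
    ℕ→ℚ (m C k) * fallingℚ (ℕ→ℚ n) k * ℕ→ℚ (j !)      ∎
  regroup : ∀ s c f w → s * (c * f) * w ≡ c * (s * f * w)
  regroup = solve-∀ ℚ-ring

mainTheorem15 : (p : ℕ) → Prime p → ¬ (2 ∣ p) → (m n : ℕ) →
    FermionicIntegralIs p (λ x → ℤ→ℚ (falling (+ x) n) * ℤ→ℚ (falling (+ x) m)) (rhs15 m n)
mainTheorem15 p p-prime p-odd m n M = M , λ N M≤N →
  subst (PAdicSmall p M) (sym (difference (p ℕ.^ N))) (small-sumTo (suc m) λ k →
    subst (PAdicSmall p M) (cong (_* error N k) (sym (productCoeff-ℤ n m k)))
      (small-ℤ* (+ (m C k) ℤ.* falling (+ n) k) {error N k}
        (altFallingSum≈fallingIntegral p-prime p-odd M≤N (j k))))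
  where
  open PAdicSmallness p-prime M
  j : ℕ → ℕ
  j k = m ℕ.+ n ∸ k
  error : ℕ → ℕ → ℚ
  error N k = altFallingSum (p ℕ.^ N) (j k) - fallingIntegral (j k)
  f : ℕ → ℚ
  f x = ℤ→ℚ (falling (+ x) n) * ℤ→ℚ (falling (+ x) m)
  difference : ∀ K → altSum K f - rhs15 m n
    ≡ sumTo (suc m) (λ k → productCoeff n m k * (altFallingSum K (j k) - fallingIntegral (j k)))
  difference K = begin
    altSum K f - rhs15 m n
      ≡⟨ cong₂ _-_ (altSum-falling-product K m n) (rhs15-expansion m n) ⟩
    sumTo (suc m) (λ k → productCoeff n m k * altFallingSum K (j k)) - sumTo (suc m) (λ k → productCoeff n m k * fallingIntegral (j k))
      ≡⟨ sumTo-distrib-sub (suc m) _ _ ⟨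
    sumTo (suc m) (λ k → productCoeff n m k * altFallingSum K (j k) - productCoeff n m k * fallingIntegral (j k))
      ≡⟨ sumTo-cong (suc m) (λ k _ → sym (*-distribˡ-sub (productCoeff n m k) _ _)) ⟩
    sumTo (suc m) (λ k → productCoeff n m k * (altFallingSum K (j k) - fallingIntegral (j k)))
      ∎
    where
    open ≡-Reasoning
    *-distribˡ-sub : ∀ a b c → a * (b - c) ≡ a * b - a * c
    *-distribˡ-sub = solve-∀ ℚ-ring
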